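{- Let $n$ and $r$ be positive integers. For a non-negative integer $a$ and a positive integer $b$, let $P(a,b)$ denote the number of lattice paths in the plane using unit steps $(1,0)$ and $(0,1)$ from $(0,0)$ to $(a+b,\,a+b-1)$ that never touch any point of the set $\{(x,x)\in\mathbb{Z}^2 : x\ge b\}$. Then \[ P(n-1,r+1)-P(n,r)=\binom{2r}{r}\,C_{n-1}, \] where $C_m=\frac{1}{m+1}\binom{2m}{m}$ is the $m$th Catalan number.
   Context: $P(a,b)$ is called the Gessel number. $C_m=\frac{1}{m+1}\binom{2m}{m}$ denotes the $m$th Catalan number. -}

module Defs where

open import Data.Nat using (ℕ; zero; suc; _+_; _*_; _∸_; _≡ᵇ_; _≤ᵇ_; _/_)
open import Data.Nat.Combinatorics using (_C_)
open import Data.Bool using (Bool; true; false; _∧_; not)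
open import Data.List using (List; []; _∷_; map; _++_; length; filterᵇ)

data Step : Set where
  E N : Step

allSeqs : ℕ → List (List Step)
allSeqs zero = [] ∷ []
allSeqs (suc k) = map (E ∷_) (allSeqs k) ++ map (N ∷_) (allSeqs k)

forbidden : ℕ → ℕ → ℕ → Bool
forbidden b x y = (x ≡ᵇ y) ∧ (b ≤ᵇ x)

okFrom : (b tx ty x y : ℕ) → List Step → Bool
okFrom b tx ty x y s = not (forbidden b x y) ∧ rest s
  where
  rest : List Step → Bool
  rest [] = (x ≡ᵇ tx) ∧ (y ≡ᵇ ty)
  rest (E ∷ s') = okFrom b tx ty (suc x) y s'
  rest (N ∷ s') = okFrom b tx ty x (suc y) s'

avoidingPaths : (b tx ty : ℕ) → ℕ
avoidingPaths b tx ty = length (filterᵇ (okFrom b tx ty 0 0) (allSeqs (tx + ty)))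

P : ℕ → ℕ → ℕ
P a b = avoidingPaths b (a + b) (a + b ∸ 1)

-- Catalan number C_m = binom(2m,m)/(m+1) (exact division)
catalan : ℕ → ℕ
catalan m = ((2 * m) C m) / suc m

{-# OPTIONS --safe #-}
module Submission where

-- P(n-1, r+1) and P(n, r) both count walks from (0,0) to (n+r, n+r-1): the first avoid the
-- diagonal from r+1 on, the second from r on.  The two barriers differ only at (r, r), so the
-- difference counts the walks through (r, r): C(2r, r) ways to reach it, times the walks from
-- (r, r) avoiding the diagonal from r+1 on.  Such a walk steps east and then stays strictly
-- below the diagonal, so it is counted by the ballot recursion; the reflection principle writes
-- the ballot numbers as differences of binomial coefficients, and the absorption identity
-- k C(n,k) = n C(n-1,k-1) turns the central one into C(2m,m)/(m+1).

open import Defs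
open import Algebra.Properties.CommutativeSemigroup using (interchange)
open import Data.Bool using (Bool; true; false; not; _∧_; if_then_else_; T)
open import Data.Bool.Properties using (if-∧; if-not; if-eta)
open import Data.Empty using (⊥-elim)
open import Data.Unit using (tt)
open import Data.List using (List; []; _∷_; map; _++_; length; filterᵇ)
open import Data.List.Properties using (length-++; filter-++)
open import Data.Nat
open import Data.Nat.Combinatorics
  using (_C_; nC1≡n; nCk≡nC[n∸k]; k>n⇒nCk≡0; nCk+nC[k+1]≡[n+1]C[k+1])
open import Data.Nat.DivMod using (m*n/n≡m)
open import Data.Nat.Properties
open import Data.Nat.Tactic.RingSolver using (solve-∀)
open import Data.Product using (_×_; _,_)
open import Data.Sum using (_⊎_; inj₁; inj₂; reduce; map₁; map₂)
open import Function using (_∘_)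
open import Relation.Nullary using (¬_; yes; no)
open import Relation.Nullary.Decidable using (T?)
open import Relation.Binary.PropositionalEquality

+-interchange : ∀ a b c d → (a + b) + (c + d) ≡ (a + c) + (b + d)
+-interchange = interchange +-commutativeSemigroup

module _ {A : Set} where

  length-filterᵇ-singleton : ∀ (p : A → Bool) a →
    length (filterᵇ p (a ∷ [])) ≡ (if p a then 1 else 0)
  length-filterᵇ-singleton p a with p a
  ... | true  = refl
  ... | false = refl

  length-filterᵇ-false : ∀ (xs : List A) → length (filterᵇ (λ _ → false) xs) ≡ 0
  length-filterᵇ-false []       = refl
  length-filterᵇ-false (_ ∷ xs) = length-filterᵇ-false xs

  length-filterᵇ-++ : ∀ (p : A → Bool) xs ys →
    length (filterᵇ p (xs ++ ys)) ≡ length (filterᵇ p xs) + length (filterᵇ p ys)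
  length-filterᵇ-++ p xs ys =
    trans (cong length (filter-++ (T? ∘ p) xs ys)) (length-++ (filterᵇ p xs))

  length-filterᵇ-map : ∀ {B : Set} (p : B → Bool) (f : A → B) xs →
    length (filterᵇ p (map f xs)) ≡ length (filterᵇ (p ∘ f) xs)
  length-filterᵇ-map p f []       = refl
  length-filterᵇ-map p f (x ∷ xs) with p (f x)
  ... | true  = cong suc (length-filterᵇ-map p f xs)
  ... | false = length-filterᵇ-map p f xs

length-filterᵇ-allSeqs : ∀ (p : List Step → Bool) k →
  length (filterᵇ p (allSeqs (suc k))) ≡
  length (filterᵇ (p ∘ (E ∷_)) (allSeqs k)) + length (filterᵇ (p ∘ (N ∷_)) (allSeqs k))
length-filterᵇ-allSeqs p k = begin
  length (filterᵇ p (map (E ∷_) L ++ map (N ∷_) L))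
    ≡⟨ length-filterᵇ-++ p (map (E ∷_) L) (map (N ∷_) L) ⟩
  length (filterᵇ p (map (E ∷_) L)) + length (filterᵇ p (map (N ∷_) L))
    ≡⟨ cong₂ _+_ (length-filterᵇ-map p (E ∷_) L) (length-filterᵇ-map p (N ∷_) L) ⟩
  length (filterᵇ (p ∘ (E ∷_)) L) + length (filterᵇ (p ∘ (N ∷_)) L) ∎
  where
  open ≡-Reasoning
  L = allSeqs k

∧≡true : ∀ {p q} → T p → T q → p ∧ q ≡ true
∧≡true {true} {true} _ _ = refl

∧≡false : ∀ {p q} → ¬ (T p × T q) → p ∧ q ≡ false
∧≡false {true}  {true}  ¬pq = ⊥-elim (¬pq (tt , tt))
∧≡false {true}  {false} _   = refl
∧≡false {false}         _   = refl

forbidden-true : ∀ {b x y} → x ≡ y → b ≤ x → forbidden b x y ≡ true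
forbidden-true {x = x} {y} x≡y b≤x = ∧≡true (≡⇒≡ᵇ x y x≡y) (≤⇒≤ᵇ b≤x)

forbidden-false : ∀ {b x y} → ¬ (x ≡ y × b ≤ x) → forbidden b x y ≡ false
forbidden-false {b} {x} {y} allowed =
  ∧≡false λ (x≡ᵇy , b≤ᵇx) → allowed (≡ᵇ⇒≡ x y x≡ᵇy , ≤ᵇ⇒≤ b x b≤ᵇx)

forbidden-below : ∀ {b x y} → x < b → forbidden b x y ≡ false
forbidden-below x<b = forbidden-false λ (_ , b≤x) → <⇒≱ x<b b≤x

forbidden-off-diagonal : ∀ {b x y} → x ≢ y → forbidden b x y ≡ false
forbidden-off-diagonal {b} x≢y = forbidden-false {b} λ (x≡y , _) → x≢y x≡y

forbidden-suc : ∀ {r x y} → r < x ⊎ r < y → forbidden (suc r) x y ≡ forbidden r x y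
forbidden-suc {r} {x} {y} beyond with x ≟ y
... | no x≢y   =
  trans (forbidden-off-diagonal {suc r} x≢y) (sym (forbidden-off-diagonal {r} x≢y))
... | yes refl =
  trans (forbidden-true refl (reduce beyond)) (sym (forbidden-true refl (<⇒≤ (reduce beyond))))

[n+1]C[k+1]*m≡nCk*m+nC[k+1]*m : ∀ n k m →
  (suc n C suc k) * m ≡ (n C k) * m + (n C suc k) * m
[n+1]C[k+1]*m≡nCk*m+nC[k+1]*m n k m =
  trans (cong (_* m) (sym (nCk+nC[k+1]≡[n+1]C[k+1] n k))) (*-distribʳ-+ m (n C k) (n C suc k))

module Walks (tx ty : ℕ) where

  walks : (b k x y : ℕ) → ℕ
  walks b zero    x y = if forbidden b x y then 0 else (if (x ≡ᵇ tx) ∧ (y ≡ᵇ ty) then 1 else 0)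
  walks b (suc k) x y = if forbidden b x y then 0 else walks b k (suc x) y + walks b k x (suc y)

  length-filterᵇ-okFrom : ∀ b k x y →
    length (filterᵇ (okFrom b tx ty x y) (allSeqs k)) ≡ walks b k x y
  length-filterᵇ-okFrom b zero x y =
    trans (length-filterᵇ-singleton (okFrom b tx ty x y) [])
          (trans (if-∧ (not (forbidden b x y))) (if-not (forbidden b x y)))
  length-filterᵇ-okFrom b (suc k) x y = begin
    length (filterᵇ (okFrom b tx ty x y) (allSeqs (suc k)))
      ≡⟨ length-filterᵇ-allSeqs (okFrom b tx ty x y) k ⟩
    length (filterᵇ (λ s → not f ∧ east s) L) + length (filterᵇ (λ s → not f ∧ north s) L)
      ≡⟨ guarded f ⟩
    (if f then 0 else length (filterᵇ east L) + length (filterᵇ north L))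
      ≡⟨ cong (λ n → if f then 0 else n)
              (cong₂ _+_ (length-filterᵇ-okFrom b k (suc x) y) (length-filterᵇ-okFrom b k x (suc y))) ⟩
    walks b (suc k) x y ∎
    where
    open ≡-Reasoning
    f = forbidden b x y
    east north : List Step → Bool
    east  = okFrom b tx ty (suc x) y
    north = okFrom b tx ty x (suc y)
    L = allSeqs k
    guarded : ∀ c {p q : List Step → Bool} →
      length (filterᵇ (λ s → not c ∧ p s) L) + length (filterᵇ (λ s → not c ∧ q s) L) ≡
      (if c then 0 else length (filterᵇ p L) + length (filterᵇ q L))
    guarded false = refl
    guarded true  = cong₂ _+_ (length-filterᵇ-false L) (length-filterᵇ-false L)

  avoidingPaths≡walks : ∀ b → avoidingPaths b tx ty ≡ walks b (tx + ty) 0 0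
  avoidingPaths≡walks b = length-filterᵇ-okFrom b (tx + ty) 0 0

  walks-forbidden : ∀ b k {x y} → forbidden b x y ≡ true → walks b k x y ≡ 0
  walks-forbidden b zero    {x} {y} forb rewrite forb = refl
  walks-forbidden b (suc k) {x} {y} forb rewrite forb = refl

  walks-step : ∀ b k {x y} → forbidden b x y ≡ false →
    walks b (suc k) x y ≡ walks b k (suc x) y + walks b k x (suc y)
  walks-step b k {x} {y} allowed rewrite allowed = refl

  walks-at-target : ∀ b {x y} → forbidden b x y ≡ false → x ≡ tx → y ≡ ty → walks b 0 x y ≡ 1
  walks-at-target b {x} {y} allowed x≡tx y≡ty =
    cong₂ (λ c e → if c then 0 else (if e then 1 else 0))
          allowed (∧≡true (≡⇒≡ᵇ x tx x≡tx) (≡⇒≡ᵇ y ty y≡ty))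

  walks-off-target : ∀ b {x y} → ¬ (x ≡ tx × y ≡ ty) → walks b 0 x y ≡ 0
  walks-off-target b {x} {y} off =
    trans (cong (λ e → if forbidden b x y then 0 else (if e then 1 else 0))
                (∧≡false λ (x≡ᵇtx , y≡ᵇty) → off (≡ᵇ⇒≡ x tx x≡ᵇtx , ≡ᵇ⇒≡ y ty y≡ᵇty)))
          (if-eta (forbidden b x y))

  walks-overshoot : ∀ b k {x y} → tx < x → walks b k x y ≡ 0
  walks-overshoot b zero    tx<x = walks-off-target b λ (x≡tx , _) → <⇒≢ tx<x (sym x≡tx)
  walks-overshoot b (suc k) {x} {y} tx<x =
    trans (cong (λ n → if forbidden b x y then 0 else n)
                (cong₂ _+_ (walks-overshoot b k (m<n⇒m<1+n tx<x)) (walks-overshoot b k tx<x)))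
          (if-eta (forbidden b x y))

  walks-above : ∀ b k {x y} → ty < tx → x ≤ y → b ≤ y → walks b k x y ≡ 0
  walks-above b zero ty<tx x≤y b≤y =
    walks-off-target b λ (x≡tx , y≡ty) → <⇒≱ ty<tx (subst₂ _≤_ x≡tx y≡ty x≤y)
  walks-above b (suc k) {x} {y} ty<tx x≤y b≤y with x ≟ y
  ... | yes refl = walks-forbidden b (suc k) (forbidden-true refl b≤y)
  ... | no x≢y   = trans (walks-step b k (forbidden-off-diagonal {b} x≢y))
    (cong₂ _+_ (walks-above b k ty<tx (≤∧≢⇒< x≤y x≢y) b≤y)
               (walks-above b k ty<tx (m≤n⇒m≤1+n x≤y) (m≤n⇒m≤1+n b≤y)))

  walks-beyond : ∀ r k {x y} → r < x ⊎ r < y → walks (suc r) k x y ≡ walks r k x y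
  walks-beyond r zero    beyond = cong (λ c → if c then 0 else _) (forbidden-suc beyond)
  walks-beyond r (suc k) beyond = cong₂ (λ c n → if c then 0 else n) (forbidden-suc beyond)
    (cong₂ _+_ (walks-beyond r k (map₁ m<n⇒m<1+n beyond))
               (walks-beyond r k (map₂ m<n⇒m<1+n beyond)))

  walks-detour-step : ∀ r k {x y A B} → forbidden (suc r) x y ≡ false → forbidden r x y ≡ false →
    walks (suc r) k (suc x) y ≡ walks r k (suc x) y + A →
    walks (suc r) k x (suc y) ≡ walks r k x (suc y) + B →
    walks (suc r) (suc k) x y ≡ walks r (suc k) x y + (A + B)
  walks-detour-step r k {x} {y} {A} {B} allowed₁ allowed eastward northward = begin
    walks (suc r) (suc k) x y
      ≡⟨ walks-step (suc r) k allowed₁ ⟩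
    walks (suc r) k (suc x) y + walks (suc r) k x (suc y)
      ≡⟨ cong₂ _+_ eastward northward ⟩
    (walks r k (suc x) y + A) + (walks r k x (suc y) + B)
      ≡⟨ +-interchange (walks r k (suc x) y) A (walks r k x (suc y)) B ⟩
    (walks r k (suc x) y + walks r k x (suc y)) + (A + B)
      ≡⟨ cong (_+ (A + B)) (walks-step r k allowed) ⟨
    walks r (suc k) x y + (A + B) ∎
    where open ≡-Reasoning

  walks-detour : ∀ r p q j {x y} → p + x ≡ r → q + y ≡ r →
    walks (suc r) (p + q + j) x y ≡ walks r (p + q + j) x y + ((p + q) C p) * walks (suc r) j r r
  walks-detour r zero zero j refl refl =
    sym (cong₂ _+_ (walks-forbidden r j (forbidden-true {r} refl ≤-refl))
                   (+-identityʳ (walks (suc r) j r r)))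
  walks-detour r (suc p) zero j {x} {y} px≡r refl = trans
    (walks-detour-step r k (forbidden-below {y = y} (m<n⇒m<1+n x<r)) (forbidden-below {y = y} x<r)
      (walks-detour r p zero j (trans (+-suc p x) px≡r) refl)
      (trans (walks-beyond r k (inj₂ ≤-refl))
      (trans (sym (+-identityʳ (walks r k x (suc y))))
             (cong (λ c → walks r k x (suc y) + c * H)
                   (sym (k>n⇒nCk≡0 (s≤s (≤-reflexive (+-identityʳ p)))))))))
    (cong (walks r (suc k) x y +_) (sym ([n+1]C[k+1]*m≡nCk*m+nC[k+1]*m (p + 0) p H)))
    where
    k = p + 0 + j
    H = walks (suc r) j r r
    x<r : x < r
    x<r = ≤-trans (s≤s (m≤n+m x p)) (≤-reflexive px≡r)
  walks-detour r zero (suc q) j {x} {y} refl qy≡r =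
    walks-detour-step r k (forbidden-below {y = y} (n<1+n x)) (forbidden-off-diagonal {r} (<⇒≢ y<x ∘ sym))
      (trans (walks-beyond r k (inj₁ ≤-refl)) (sym (+-identityʳ (walks r k (suc x) y))))
      (walks-detour r zero q j refl (trans (+-suc q y) qy≡r))
    where
    k = q + j
    y<x : y < x
    y<x = ≤-trans (s≤s (m≤n+m y q)) (≤-reflexive qy≡r)
  walks-detour r (suc p) (suc q) j {x} {y} px≡r qy≡r = trans
    (walks-detour-step r k (forbidden-below {y = y} (m<n⇒m<1+n x<r)) (forbidden-below {y = y} x<r)
      (walks-detour r p (suc q) j (trans (+-suc p x) px≡r) qy≡r)
      (subst₂ (λ k n → walks (suc r) k x (suc y) ≡ walks r k x (suc y) + (n C suc p) * H)
              (cong (_+ j) (sym (+-suc p q))) (sym (+-suc p q))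
              (walks-detour r (suc p) q j px≡r (trans (+-suc q y) qy≡r))))
    (cong (walks r (suc k) x y +_) (sym ([n+1]C[k+1]*m≡nCk*m+nC[k+1]*m (p + suc q) p H)))
    where
    k = p + suc q + j
    H = walks (suc r) j r r
    x<r : x < r
    x<r = ≤-trans (s≤s (m≤n+m x p)) (≤-reflexive px≡r)

-- ballot i d counts the walks with i east and i + d north steps that start d + 1 below the
-- diagonal and never touch it.
ballot : ℕ → ℕ → ℕ
ballot zero    d       = 1
ballot (suc i) zero    = ballot i 1
ballot (suc i) (suc d) = ballot i (suc (suc d)) + ballot (suc i) d

ballot-one : ∀ d → ballot 1 d ≡ suc d
ballot-one zero    = refl
ballot-one (suc d) = cong suc (ballot-one d)

m+n≡o⇒oCm≡oCn : ∀ m n {o} → m + n ≡ o → o C m ≡ o C n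
m+n≡o⇒oCm≡oCn m n refl = trans (nCk≡nC[n∸k] (m≤m+n m n)) (cong ((m + n) C_) (m+n∸m≡n m n))

ballot-reflection : ∀ i d n → n ≡ suc i + (suc i + d) → ballot (suc i) d + n C i ≡ n C suc i
ballot-reflection zero d n refl = begin
  ballot 1 d + 1    ≡⟨ cong (_+ 1) (ballot-one d) ⟩
  suc d + 1         ≡⟨ +-comm (suc d) 1 ⟩
  suc (suc d)       ≡⟨ nC1≡n (suc (suc d)) ⟨
  suc (suc d) C 1   ∎
  where open ≡-Reasoning
ballot-reflection (suc i) zero (suc n) n≡ = begin
  ballot (suc i) 1 + suc n C suc i
    ≡⟨ cong (ballot (suc i) 1 +_) (nCk+nC[k+1]≡[n+1]C[k+1] n i) ⟨
  ballot (suc i) 1 + (n C i + n C suc i)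
    ≡⟨ +-assoc (ballot (suc i) 1) (n C i) (n C suc i) ⟨
  (ballot (suc i) 1 + n C i) + n C suc i
    ≡⟨ cong (_+ n C suc i) (ballot-reflection i 1 n (suc-injective (trans n≡ (arith i)))) ⟩
  n C suc i + n C suc i
    ≡⟨ cong (n C suc i +_) (m+n≡o⇒oCm≡oCn (suc i) (suc (suc i)) (sym (arith′ i n n≡))) ⟩
  n C suc i + n C suc (suc i)
    ≡⟨ nCk+nC[k+1]≡[n+1]C[k+1] n (suc i) ⟩
  suc n C suc (suc i) ∎
  where
  open ≡-Reasoning
  arith : ∀ i → suc (suc i) + (suc (suc i) + 0) ≡ suc (suc i + (suc i + 1))
  arith = solve-∀
  arith′ : ∀ i n → suc n ≡ suc (suc i) + (suc (suc i) + 0) → n ≡ suc i + suc (suc i)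
  arith′ i n n≡ = trans (suc-injective n≡) (cong (λ z → suc i + suc z) (+-identityʳ (suc i)))
ballot-reflection (suc i) (suc d) (suc n) n≡ = begin
  (ballot (suc i) (suc (suc d)) + ballot (suc (suc i)) d) + suc n C suc i
    ≡⟨ cong (_ +_) (nCk+nC[k+1]≡[n+1]C[k+1] n i) ⟨
  (ballot (suc i) (suc (suc d)) + ballot (suc (suc i)) d) + (n C i + n C suc i)
    ≡⟨ +-interchange (ballot (suc i) (suc (suc d))) (ballot (suc (suc i)) d) (n C i) (n C suc i) ⟩
  (ballot (suc i) (suc (suc d)) + n C i) + (ballot (suc (suc i)) d + n C suc i)
    ≡⟨ cong₂ _+_ (ballot-reflection i (suc (suc d)) n (suc-injective (trans n≡ (arith i d))))
                 (ballot-reflection (suc i) d n (suc-injective (trans n≡ (arith′ i d)))) ⟩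
  n C suc i + n C suc (suc i)
    ≡⟨ nCk+nC[k+1]≡[n+1]C[k+1] n (suc i) ⟩
  suc n C suc (suc i) ∎
  where
  open ≡-Reasoning
  arith : ∀ i d → suc (suc i) + (suc (suc i) + suc d) ≡ suc (suc i + (suc i + suc (suc d)))
  arith = solve-∀
  arith′ : ∀ i d → suc (suc i) + (suc (suc i) + suc d) ≡ suc (suc (suc i) + (suc (suc i) + d))
  arith′ = solve-∀

[k+1]*[n+1]C[k+1]≡[n+1]*nCk : ∀ n k → suc k * (suc n C suc k) ≡ suc n * (n C k)
[k+1]*[n+1]C[k+1]≡[n+1]*nCk zero    zero    = refl
[k+1]*[n+1]C[k+1]≡[n+1]*nCk zero    (suc k) = *-zeroʳ (suc (suc k))
[k+1]*[n+1]C[k+1]≡[n+1]*nCk (suc n) zero    =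
  trans (+-identityʳ (suc (suc n) C 1)) (trans (nC1≡n (suc (suc n))) (sym (*-identityʳ (suc (suc n)))))
[k+1]*[n+1]C[k+1]≡[n+1]*nCk (suc n) (suc k) = begin
  suc (suc k) * (suc m C suc (suc k))
    ≡⟨ cong (suc (suc k) *_) (nCk+nC[k+1]≡[n+1]C[k+1] m (suc k)) ⟨
  suc (suc k) * (m C suc k + m C suc (suc k))
    ≡⟨ *-distribˡ-+ (suc (suc k)) (m C suc k) (m C suc (suc k)) ⟩
  (m C suc k + suc k * (m C suc k)) + suc (suc k) * (m C suc (suc k))
    ≡⟨ cong₂ _+_ (cong (m C suc k +_) ([k+1]*[n+1]C[k+1]≡[n+1]*nCk n k))
                 ([k+1]*[n+1]C[k+1]≡[n+1]*nCk n (suc k)) ⟩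
  (m C suc k + m * (n C k)) + m * (n C suc k)
    ≡⟨ +-assoc (m C suc k) (m * (n C k)) (m * (n C suc k)) ⟩
  m C suc k + (m * (n C k) + m * (n C suc k))
    ≡⟨ cong (m C suc k +_) (*-distribˡ-+ m (n C k) (n C suc k)) ⟨
  m C suc k + m * (n C k + n C suc k)
    ≡⟨ cong (λ c → m C suc k + m * c) (nCk+nC[k+1]≡[n+1]C[k+1] n k) ⟩
  suc m * (m C suc k) ∎
  where
  open ≡-Reasoning
  m = suc n

catalan≡ballot : ∀ m → catalan m ≡ ballot m 0
catalan≡ballot zero    = refl
catalan≡ballot (suc i) = begin
  D / suc m             ≡⟨ cong (_/ suc m) D≡B*[m+1] ⟩
  (B * suc m) / suc m   ≡⟨ m*n/n≡m B (suc m) ⟩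
  B                     ∎
  where
  open ≡-Reasoning
  m = suc i
  B = ballot m 0
  c = (2 * m) C i
  D = (2 * m) C m
  reflection : B + c ≡ D
  reflection = ballot-reflection i 0 (2 * m) refl
  absorption : m * D ≡ suc m * c
  absorption = begin
    suc i * (suc n₀ C suc i)
      ≡⟨ [k+1]*[n+1]C[k+1]≡[n+1]*nCk n₀ i ⟩
    suc n₀ * (n₀ C i)
      ≡⟨ cong (suc n₀ *_) (m+n≡o⇒oCm≡oCn i (suc i) (cong (λ z → i + suc z) (sym (+-identityʳ i)))) ⟩
    suc n₀ * (n₀ C suc i)
      ≡⟨ [k+1]*[n+1]C[k+1]≡[n+1]*nCk n₀ (suc i) ⟨
    suc m * (suc n₀ C suc m)
      ≡⟨ cong (suc m *_) (m+n≡o⇒oCm≡oCn (suc m) i (arith i)) ⟩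
    suc m * (suc n₀ C i) ∎
    where
    n₀ = i + suc (i + 0)
    arith : ∀ i → suc (suc i) + i ≡ suc (i + suc (i + 0))
    arith = solve-∀
  D≡B*[m+1] : D ≡ B * suc m
  D≡B*[m+1] = +-cancelʳ-≡ (m * D) D (B * suc m) (begin
    suc m * D              ≡⟨ cong (suc m *_) reflection ⟨
    suc m * (B + c)        ≡⟨ *-distribˡ-+ (suc m) B c ⟩
    suc m * B + suc m * c  ≡⟨ cong₂ _+_ (*-comm B (suc m)) absorption ⟨
    B * suc m + m * D      ∎)

module _ (t : ℕ) where
  open Walks (suc t) t

  private
    gap : ∀ {x y} i d → x + i ≡ suc t → y + (i + d) ≡ t → x ≡ suc (y + d)
    gap {x} {y} i d x≡ y≡ =
      +-cancelʳ-≡ i x (suc (y + d)) (trans x≡ (trans (cong suc (sym y≡)) (arith y i d)))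
      where
      arith : ∀ y i d → suc (y + (i + d)) ≡ suc (y + d) + i
      arith = solve-∀

    below-diagonal : ∀ b {x y} i d → x + i ≡ suc t → y + (i + d) ≡ t → forbidden b x y ≡ false
    below-diagonal b {x} {y} i d x≡ y≡ = forbidden-off-diagonal {b} λ x≡y →
      <-irrefl (sym x≡y) (subst (y <_) (sym (gap i d x≡ y≡)) (s≤s (m≤m+n y d)))

    east-steps : ∀ {k} i d → suc k ≡ suc i + (suc i + d) → k ≡ i + (i + suc d)
    east-steps i d k≡ = trans (suc-injective k≡) (cong (i +_) (sym (+-suc i d)))

    east-y : ∀ {y} i d → y + (suc i + d) ≡ t → y + (i + suc d) ≡ t
    east-y {y} i d y≡ = trans (cong (y +_) (+-suc i d)) y≡

  walks≡ballot : ∀ b k i d {x y} → k ≡ i + (i + d) → x + i ≡ suc t → y + (i + d) ≡ t → b ≤ x →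
    walks b k x y ≡ ballot i d
  walks≡ballot b zero zero zero {x} {y} refl x≡ y≡ b≤x =
    walks-at-target b (below-diagonal b 0 0 x≡ y≡)
      (trans (sym (+-identityʳ x)) x≡) (trans (sym (+-identityʳ y)) y≡)
  walks≡ballot b (suc k) zero (suc d) {x} {y} k≡ x≡ y≡ b≤x =
    trans (walks-step b k (below-diagonal b 0 (suc d) x≡ y≡))
      (cong₂ _+_ (walks-overshoot b k (s≤s (≤-reflexive (trans (sym x≡) (+-identityʳ x)))))
                 (walks≡ballot b k zero d (suc-injective k≡) x≡ (trans (sym (+-suc y d)) y≡) b≤x))
  walks≡ballot b (suc k) (suc i) zero {x} {y} k≡ x≡ y≡ b≤x =
    trans (walks-step b k (below-diagonal b (suc i) 0 x≡ y≡))
      (trans (cong₂ _+_ eastward northward) (+-identityʳ (ballot i 1)))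
    where
    eastward : walks b k (suc x) y ≡ ballot i 1
    eastward = walks≡ballot b k i 1 (east-steps i 0 k≡) (trans (sym (+-suc x i)) x≡)
                            (east-y i 0 y≡) (m≤n⇒m≤1+n b≤x)
    northward : walks b k x (suc y) ≡ 0
    northward = walks-forbidden b k
      (forbidden-true (trans (gap (suc i) 0 x≡ y≡) (cong suc (+-identityʳ y))) b≤x)
  walks≡ballot b (suc k) (suc i) (suc d) {x} {y} k≡ x≡ y≡ b≤x =
    trans (walks-step b k (below-diagonal b (suc i) (suc d) x≡ y≡)) (cong₂ _+_ eastward northward)
    where
    eastward : walks b k (suc x) y ≡ ballot i (suc (suc d))
    eastward = walks≡ballot b k i (suc (suc d)) (east-steps i (suc d) k≡)
                            (trans (sym (+-suc x i)) x≡) (east-y i (suc d) y≡) (m≤n⇒m≤1+n b≤x)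
    north-steps : ∀ i d → suc i + (suc i + suc d) ≡ suc (suc i + (suc i + d))
    north-steps = solve-∀
    north-y : ∀ y i d → suc y + (suc i + d) ≡ y + (suc i + suc d)
    north-y = solve-∀
    northward : walks b k x (suc y) ≡ ballot (suc i) d
    northward = walks≡ballot b k (suc i) d (suc-injective (trans k≡ (north-steps i d))) x≡
                             (trans (north-y y i d) y≡) b≤x

  walks-from-diagonal : ∀ r m → r + m ≡ t → walks (suc r) (suc (m + (m + 0))) r r ≡ ballot m 0
  walks-from-diagonal r m r+m≡t = begin
    walks (suc r) (suc k) r r
      ≡⟨ walks-step (suc r) k (forbidden-below {x = r} {y = r} ≤-refl) ⟩
    walks (suc r) k (suc r) r + walks (suc r) k r (suc r)
      ≡⟨ cong₂ _+_ eastward northward ⟩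
    ballot m 0 + 0
      ≡⟨ +-identityʳ (ballot m 0) ⟩
    ballot m 0 ∎
    where
    open ≡-Reasoning
    k = m + (m + 0)
    eastward : walks (suc r) k (suc r) r ≡ ballot m 0
    eastward = walks≡ballot (suc r) k m 0 refl (cong suc r+m≡t)
                            (trans (cong (r +_) (+-identityʳ m)) r+m≡t) ≤-refl
    northward : walks (suc r) k r (suc r) ≡ 0
    northward = walks-above (suc r) k (n<1+n t) (n≤1+n r) ≤-refl

theorem2 : (n r : ℕ) → n ≥ 1 → r ≥ 1 →
    P (n ∸ 1) (r + 1) ≡ P n r + ((2 * r) C r) * catalan (n ∸ 1)
theorem2 (suc m) r _ _ = begin
  P m (r + 1)                              ≡⟨ cong₂ (λ b s → avoidingPaths b s (s ∸ 1)) (+-comm r 1) (arith₁ m r) ⟩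
  avoidingPaths (suc r) (suc t) t          ≡⟨ avoidingPaths≡walks (suc r) ⟩
  walks (suc r) K 0 0                      ≡⟨ detour ⟩
  walks r K 0 0 + ((r + r) C r) * H        ≡⟨ cong₂ _+_ (avoidingPaths≡walks r) (cong₂ _*_ central-binomial diagonal) ⟨
  P (suc m) r + ((2 * r) C r) * catalan m  ∎
  where
  open ≡-Reasoning
  t = m + r
  open Walks (suc t) t
  K = suc t + t
  j = suc (m + (m + 0))
  H = walks (suc r) j r r
  arith₁ : ∀ m r → m + (r + 1) ≡ suc (m + r)
  arith₁ = solve-∀
  arith₂ : ∀ m r → r + r + suc (m + (m + 0)) ≡ suc (m + r) + (m + r)
  arith₂ = solve-∀
  detour : walks (suc r) K 0 0 ≡ walks r K 0 0 + ((r + r) C r) * H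
  detour = subst (λ k → walks (suc r) k 0 0 ≡ walks r k 0 0 + ((r + r) C r) * H) (arith₂ m r)
                 (walks-detour r r r j (+-identityʳ r) (+-identityʳ r))
  central-binomial : (2 * r) C r ≡ (r + r) C r
  central-binomial = cong (λ n → (r + n) C r) (+-identityʳ r)
  diagonal : catalan m ≡ H
  diagonal = trans (catalan≡ballot m) (sym (walks-from-diagonal t r m (+-comm r m)))
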